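{- Let $k\ge 4$. Let $X_k=\{v_1,\dots,v_{2k-1}\}$, $\mathscr{M}_k=\{M_i=\{v_i,v_{i+1},\dots,v_{i+k-1}\}: i\in\{1,\dots,k\}\}$, and let $G^*_k=(X^*_k,\mathscr{M}^*_k)$ with $X^*_k=X_k\cup\{x\}$ ($x\notin X_k$) and $\mathscr{M}^*_k=\mathscr{M}_k\cup\{M^*\}$, $M^*=\{x,v_1,\dots,v_{k-2},v_{k+2}\}$. Let $\widetilde{G}^*_k=(\widetilde{X}^*_k,\widetilde{\mathscr{M}}^*_k)$ be obtained from $G^*_k$ by adding, for each edge $M\in\mathscr{M}^*_k$, two new vertices $a_M,b_M$ (all pairwise distinct and not in $X^*_k$) and replacing $M$ by $M\cup\{a_M,b_M\}$. If $\phi$ is an automorphism of $\widetilde{G}^*_k$ with $\phi(x)=x$ and $\phi(v_{2k-1})=v_{2k-1}$, then $\phi(v)=v$ for every $v\in X^*_k$.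
   Context: An automorphism of a hypergraph $(X,\mathscr{M})$ is a bijection $\phi:X\to X$ with $\{\phi(M):M\in\mathscr{M}\}=\mathscr{M}$. -}

module Defs where

open import Data.Nat using (ℕ; suc; _+_; _*_; _∸_; _<_; _≤_)
open import Data.Fin using (Fin; toℕ)
open import Data.Product using (_×_; ∃-syntax)
open import Data.Sum using (_⊎_)
open import Relation.Binary.PropositionalEquality using (_≡_)
open import Function.Bundles using (_⇔_)
open import Function.Definitions using (Bijective)

-- Vertex set of G̃*_k.
--   v t  (t : Fin (2k-1))  is  v_{t+1}
--   x                      is  x
--   a e, b e  (e : Fin (k+1)) are a_M, b_M for the edge with index e:
--   index e < k stands for M_{e+1}, index k stands for M*.
data Vtx (k : ℕ) : Set where
  v : Fin (2 * k ∸ 1) → Vtx k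
  x : Vtx k
  a : Fin (suc k) → Vtx k
  b : Fin (suc k) → Vtx k

-- M_{i} = {v_i,…,v_{i+k-1}}, i = e+1: indices t with e ≤ t < e + k.
-- M* = {x, v_1,…,v_{k-2}, v_{k+2}}: indices t < k-2, and t = k+1.
inEdge : (k : ℕ) → Fin (suc k) → Vtx k → Set
inEdge k e (v t) =
  (toℕ e < k × toℕ e ≤ toℕ t × toℕ t < toℕ e + k)
  ⊎ (toℕ e ≡ k × (toℕ t < k ∸ 2 ⊎ toℕ t ≡ k + 1))
inEdge k e x = toℕ e ≡ k
inEdge k e (a f) = f ≡ e
inEdge k e (b f) = f ≡ e

ImageIs : (k : ℕ) → (Vtx k → Vtx k) → Fin (suc k) → Fin (suc k) → Set
ImageIs k φ e e' = ∀ y → inEdge k e' y ⇔ (∃[ z ] (inEdge k e z × φ z ≡ y))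

IsAutomorphism : (k : ℕ) → (Vtx k → Vtx k) → Set
IsAutomorphism k φ =
  Bijective {A = Vtx k} _≡_ _≡_ φ
  × (∀ e → ∃[ e' ] ImageIs k φ e e')
  × (∀ e' → ∃[ e ] ImageIs k φ e e')

-- φ permutes the edges, and M* is fixed because it is the only edge containing x.  Each v_i with
-- i < 2k-1 lies in two edges, a_M and b_M lie in one, and x is fixed, so φ maps v_i to a vertex v_j;
-- v_{2k-1} is fixed by hypothesis.  The windows M_i are fixed by downward induction on i: if all
-- edges after M_i are fixed, φ(v_{i+k-1}) lies in M_k (fixed, or for i = k by the hypothesis) and
-- in φ(M_i) = M_j with j ≤ i, hence in M_i; so the preimage of M_i contains v_{i+k-1} and
-- can only be M_i.  Finally the windows separate the vertices v_i.
module Submission where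

open import Defs
open import Data.Nat using (ℕ; zero; suc; _+_; _*_; _∸_; _≤_; _<_; z≤n; s≤s; s≤s⁻¹; _≤?_; _≟_)
open import Data.Nat.Properties
open import Data.Fin using (Fin; toℕ; fromℕ; fromℕ<)
open import Data.Fin.Properties using (toℕ-injective; toℕ<n; toℕ≤pred[n]; toℕ-fromℕ; toℕ-fromℕ<)
open import Data.Product using (_×_; _,_; proj₁; proj₂; ∃-syntax)
open import Data.Sum using (inj₁; inj₂)
open import Relation.Nullary using (¬_; yes; no; contradiction)
open import Relation.Binary.PropositionalEquality
  using (_≡_; _≢_; refl; sym; trans; cong; subst)
open import Function.Bundles using (_⇔_; mk⇔; Equivalence)
open import Function.Construct.Symmetry using (⇔-sym)
open import Function.Construct.Composition using (_⇔-∘_)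

open Equivalence using (to; from)

-- With k = m + 1, M_{j+1} consists of the v_{n+1} with InWindow m j n.
InWindow : ℕ → ℕ → ℕ → Set
InWindow m j n = j ≤ n × n ≤ j + m

SameWindows : ℕ → ℕ → ℕ → Set
SameWindows m u t = ∀ j → j ≤ m → InWindow m j u ⇔ InWindow m j t

sameWindows-sym : ∀ {m u t} → SameWindows m u t → SameWindows m t u
sameWindows-sym same j j≤m = ⇔-sym (same j j≤m)

sameWindows⇒≮ : ∀ m {u t} → u ≤ m + m → SameWindows m u t → ¬ u < t
sameWindows⇒≮ m {u} {t} u≤2m same u<t with t ≤? m | u ≤? m
... | yes t≤m | _ =
  <⇒≱ u<t (proj₁ (from (same t t≤m) (≤-refl , m≤m+n t m)))
... | no t≰m | yes u≤m =
  t≰m (proj₂ (to (same 0 z≤n) (z≤n , u≤m)))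
... | no _ | no u≰m =
  <⇒≱ u<t (subst (t ≤_) u∸m+m≡u (proj₂ (to (same (u ∸ m) u∸m≤m) u∈window)))
  where
    u∸m+m≡u : u ∸ m + m ≡ u
    u∸m+m≡u = m∸n+n≡m (<⇒≤ (≰⇒> u≰m))
    u∸m≤m : u ∸ m ≤ m
    u∸m≤m = m≤n+o⇒m∸n≤o u m u≤2m
    u∈window : InWindow m (u ∸ m) u
    u∈window = m∸n≤m u m , ≤-reflexive (sym u∸m+m≡u)

sameWindows⇒≡ : ∀ m {u t} → u ≤ m + m → t ≤ m + m → SameWindows m u t → u ≡ t
sameWindows⇒≡ m u≤2m t≤2m same =
  ≤-antisym (≮⇒≥ (sameWindows⇒≮ m t≤2m (sameWindows-sym same)))
            (≮⇒≥ (sameWindows⇒≮ m u≤2m same))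

consecutiveWindows : ∀ m n → 0 < n → n < m + m →
  ∃[ j ] suc j ≤ m × InWindow m j n × InWindow m (suc j) n
consecutiveWindows (suc m) (suc n) _ (s≤s n<2m) =
  n ∸ m , m<n+o⇒m∸n<o n m n<2m , (j≤n , n≤j+m) , (s≤s (m∸n≤m n m) , ≤-trans n≤j+m (n≤1+n _))
  where
    j≤n : n ∸ m ≤ suc n
    j≤n = ≤-trans (m∸n≤m n m) (n≤1+n n)
    n≤j+m : suc n ≤ n ∸ m + suc m
    n≤j+m = subst (suc n ≤_) (sym (+-suc (n ∸ m) m))
              (s≤s (subst (n ≤_) (+-comm m (n ∸ m)) (m≤n+m∸n n m)))

module _ {n} (σ : Fin n → Fin n) (p : ℕ) (fixed : ∀ i → p < toℕ i → σ i ≡ i) where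

  below-reflected : ∀ i → toℕ (σ i) ≤ p → toℕ i ≤ p
  below-reflected i σi≤p with toℕ i ≤? p
  ... | yes i≤p = i≤p
  ... | no i≰p = contradiction (subst (λ j → toℕ j ≤ p) (fixed i (≰⇒> i≰p)) σi≤p) i≰p

  below-preserved : (∀ {i j} → σ i ≡ σ j → i ≡ j) → ∀ i → toℕ i ≤ p → toℕ (σ i) ≤ p
  below-preserved σ-injective i i≤p with toℕ (σ i) ≤? p
  ... | yes σi≤p = σi≤p
  ... | no σi≰p =
    contradiction (subst (λ j → toℕ j ≤ p) (sym (σ-injective (fixed (σ i) (≰⇒> σi≰p)))) i≤p) σi≰p

Shared : (k : ℕ) → Vtx k → Set
Shared k z = ∃[ e ] ∃[ e′ ] e ≢ e′ × inEdge k e z × inEdge k e′ z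

a-unshared : ∀ {k f} → ¬ Shared k (a f)
a-unshared (_ , _ , e≢e′ , refl , refl) = e≢e′ refl

b-unshared : ∀ {k f} → ¬ Shared k (b f)
b-unshared (_ , _ , e≢e′ , refl , refl) = e≢e′ refl

module EdgeAction {k} {φ : Vtx k → Vtx k} (aut : IsAutomorphism k φ) where

  φ-injective : ∀ {y z} → φ y ≡ φ z → y ≡ z
  φ-injective = proj₁ (proj₁ aut)

  σ : Fin (suc k) → Fin (suc k)
  σ e = proj₁ (proj₁ (proj₂ aut) e)

  σ-image : ∀ e → ImageIs k φ e (σ e)
  σ-image e = proj₂ (proj₁ (proj₂ aut) e)

  ∈-preserved : ∀ {e z} → inEdge k e z → inEdge k (σ e) (φ z)
  ∈-preserved {e} {z} z∈e = from (σ-image e (φ z)) (z , z∈e , refl)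

  ∈-reflected : ∀ {e z} → inEdge k (σ e) (φ z) → inEdge k e z
  ∈-reflected {e} {z} φz∈σe with to (σ-image e (φ z)) φz∈σe
  ... | _ , y∈e , φy≡φz = subst (inEdge k e) (φ-injective φy≡φz) y∈e

  ∈-fixedEdge : ∀ {e z} → σ e ≡ e → inEdge k e z ⇔ inEdge k e (φ z)
  ∈-fixedEdge {e} {z} σe≡e =
    mk⇔ (λ z∈e → subst (λ d → inEdge k d (φ z)) σe≡e (∈-preserved z∈e))
        (λ φz∈e → ∈-reflected (subst (λ d → inEdge k d (φ z)) (sym σe≡e) φz∈e))

  σ-injective : ∀ {e e′} → σ e ≡ σ e′ → e ≡ e′
  σ-injective {e} σe≡σe′ =
    ∈-reflected (subst (λ d → inEdge k d (φ (a e))) σe≡σe′ (∈-preserved refl))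

  σ-surjective : ∀ e → ∃[ d ] σ d ≡ e
  σ-surjective e with proj₂ (proj₂ aut) e
  ... | d , image with to (image (a e)) refl
  ...   | z , z∈d , φz≡ae = d , sym (subst (inEdge k (σ d)) φz≡ae (∈-preserved z∈d))

  shared-preserved : ∀ {z} → Shared k z → Shared k (φ z)
  shared-preserved (e , e′ , e≢e′ , z∈e , z∈e′) =
    σ e , σ e′ , (λ σe≡σe′ → e≢e′ (σ-injective σe≡σe′)) , ∈-preserved z∈e , ∈-preserved z∈e′

  shared-v-image : φ x ≡ x → ∀ {t} → Shared k (v t) → ∃[ u ] φ (v t) ≡ v u
  shared-v-image φx≡x {t} shared with φ (v t) in φv≡
  ... | v u = u , refl
  ... | a f = contradiction (subst (Shared k) φv≡ (shared-preserved shared)) a-unshared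
  ... | b f = contradiction (subst (Shared k) φv≡ (shared-preserved shared)) b-unshared
  ... | x with φ-injective (trans φv≡ (sym φx≡x))
  ...   | ()

2[1+m]∸1≡1+2m : ∀ m → 2 * suc m ∸ 1 ≡ suc (m + m)
2[1+m]∸1≡1+2m m = trans (+-suc m (m + 0)) (cong (λ n → suc (m + n)) (+-identityʳ m))

module Geometry (m : ℕ) where

  K : ℕ
  K = suc m

  Point : Set
  Point = Fin (2 * K ∸ 1)

  Edge : Set
  Edge = Fin (suc K)

  toℕ-point≤ : ∀ (t : Point) → toℕ t ≤ m + m
  toℕ-point≤ t = s≤s⁻¹ (subst (toℕ t <_) (2[1+m]∸1≡1+2m m) (toℕ<n t))

  point : ∀ n → n ≤ m + m → Point
  point n n≤2m = fromℕ< (subst (n <_) (sym (2[1+m]∸1≡1+2m m)) (s≤s n≤2m))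

  toℕ-point : ∀ n n≤2m → toℕ (point n n≤2m) ≡ n
  toℕ-point n n≤2m = toℕ-fromℕ< _

  window : ∀ j → j ≤ m → Edge
  window j j≤m = fromℕ< (s≤s (≤-trans j≤m (n≤1+n m)))

  toℕ-window : ∀ j j≤m → toℕ (window j j≤m) ≡ j
  toℕ-window j j≤m = toℕ-fromℕ< _

  star : Edge
  star = fromℕ K

  x∈edge⇒star : ∀ {e} → inEdge K e x → e ≡ star
  x∈edge⇒star x∈e = toℕ-injective (trans x∈e (sym (toℕ-fromℕ K)))

  v∈edge⇔ : ∀ e t → toℕ e ≤ m → inEdge K e (v t) ⇔ InWindow m (toℕ e) (toℕ t)
  v∈edge⇔ e t e≤m = mk⇔ inWindow inEdge-v
    where
      inWindow : inEdge K e (v t) → InWindow m (toℕ e) (toℕ t)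
      inWindow (inj₁ (_ , e≤t , t<e+K)) = e≤t , s≤s⁻¹ (subst (toℕ t <_) (+-suc (toℕ e) m) t<e+K)
      inWindow (inj₂ (e≡K , _)) = contradiction (subst (_≤ m) e≡K e≤m) (<-irrefl refl)
      inEdge-v : InWindow m (toℕ e) (toℕ t) → inEdge K e (v t)
      inEdge-v (e≤t , t≤e+m) =
        inj₁ (s≤s e≤m , e≤t , subst (toℕ t <_) (sym (+-suc (toℕ e) m)) (s≤s t≤e+m))

  v∈window⇔ : ∀ j j≤m t → inEdge K (window j j≤m) (v t) ⇔ InWindow m j (toℕ t)
  v∈window⇔ j j≤m t =
    subst (λ i → inEdge K (window j j≤m) (v t) ⇔ InWindow m i (toℕ t)) (toℕ-window j j≤m)
      (v∈edge⇔ (window j j≤m) t (subst (_≤ m) (sym (toℕ-window j j≤m)) j≤m))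

  window≢window : ∀ {i j i≤m j≤m} → i ≢ j → window i i≤m ≢ window j j≤m
  window≢window {i} {j} {i≤m} {j≤m} i≢j eq =
    i≢j (trans (sym (toℕ-window i i≤m)) (trans (cong toℕ eq) (toℕ-window j j≤m)))

  v-shared : 2 ≤ m → ∀ {t} → toℕ t < m + m → Shared K (v t)
  v-shared 2≤m {t} t<2m with toℕ t ≟ 0
  ... | yes t≡0 =
    window 0 z≤n , star , window≢star ,
    from (v∈window⇔ 0 z≤n t) (z≤n , subst (_≤ m) (sym t≡0) z≤n) ,
    inj₂ (toℕ-fromℕ K , inj₁ (subst (_< m ∸ 1) (sym t≡0) (0<pred 2≤m)))
    where
      window≢star : window 0 z≤n ≢ star
      window≢star eq with trans (sym (toℕ-window 0 z≤n)) (trans (cong toℕ eq) (toℕ-fromℕ K))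
      ... | ()
      0<pred : ∀ {n} → 2 ≤ n → 0 < n ∸ 1
      0<pred (s≤s (s≤s _)) = s≤s z≤n
  ... | no t≢0 with consecutiveWindows m (toℕ t) (n≢0⇒n>0 t≢0) t<2m
  ...   | j , j<m , t∈j , t∈j+1 =
    window j (<⇒≤ j<m) , window (suc j) j<m ,
    window≢window {i≤m = <⇒≤ j<m} {j≤m = j<m} (<⇒≢ (n<1+n j)) ,
    from (v∈window⇔ j (<⇒≤ j<m) t) t∈j , from (v∈window⇔ (suc j) j<m t) t∈j+1

module Rigidity (m : ℕ) (2≤m : 2 ≤ m) {φ : Vtx (suc m) → Vtx (suc m)}
  (aut : IsAutomorphism (suc m) φ) (φx≡x : φ x ≡ x)
  (φ-last : ∀ t → toℕ t ≡ m + m → φ (v t) ≡ v t) where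

  open Geometry m
  open EdgeAction aut

  v-image : ∀ t → ∃[ u ] φ (v t) ≡ v u
  v-image t with toℕ t ≟ m + m
  ... | yes t≡2m = t , φ-last t t≡2m
  ... | no t≢2m = shared-v-image φx≡x (v-shared 2≤m (≤∧≢⇒< (toℕ-point≤ t) t≢2m))

  σ-star : σ star ≡ star
  σ-star = x∈edge⇒star (subst (inEdge K (σ star)) φx≡x (∈-preserved (toℕ-fromℕ K)))

  FixedFrom : ℕ → Set
  FixedFrom p = ∀ e → p ≤ toℕ e → σ e ≡ e

  module WindowStep (e : Edge) (e≤m : toℕ e ≤ m) (fixed : FixedFrom (suc (toℕ e))) where

    p : ℕ
    p = toℕ e

    w : Point
    w = point (p + m) (+-monoˡ-≤ m e≤m)

    toℕ-w : toℕ w ≡ p + m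
    toℕ-w = toℕ-point (p + m) (+-monoˡ-≤ m e≤m)

    w∈e : inEdge K e (v w)
    w∈e = from (v∈edge⇔ e w e≤m) (subst (p ≤_) (sym toℕ-w) (m≤m+n p m) , ≤-reflexive toℕ-w)

    top : Edge
    top = window m ≤-refl

    w∈top : inEdge K top (v w)
    w∈top = from (v∈window⇔ m ≤-refl w)
      (subst (m ≤_) (sym toℕ-w) (m≤n+m m p) , subst (_≤ m + m) (sym toℕ-w) (+-monoˡ-≤ m e≤m))

    φw∈top : inEdge K top (φ (v w))
    φw∈top with p ≟ m
    ... | yes p≡m = subst (inEdge K top) (sym (φ-last w (trans toℕ-w (cong (_+ m) p≡m)))) w∈top
    ... | no p≢m = to (∈-fixedEdge (fixed top p<top)) w∈top
      where
        p<top : p < toℕ top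
        p<top = subst (p <_) (sym (toℕ-window m ≤-refl)) (≤∧≢⇒< e≤m p≢m)

    u : Point
    u = proj₁ (v-image w)

    φw≡vu : φ (v w) ≡ v u
    φw≡vu = proj₂ (v-image w)

    m≤u : m ≤ toℕ u
    m≤u = proj₁ (to (v∈window⇔ m ≤-refl u) (subst (inEdge K top) φw≡vu φw∈top))

    σe≤p : toℕ (σ e) ≤ p
    σe≤p = below-preserved σ p fixed σ-injective e ≤-refl

    u≤p+m : toℕ u ≤ p + m
    u≤p+m = ≤-trans (proj₂ (to (v∈edge⇔ (σ e) u (≤-trans σe≤p e≤m))
                                 (subst (inEdge K (σ e)) φw≡vu (∈-preserved w∈e))))
                    (+-monoˡ-≤ m σe≤p)

    φw∈e : inEdge K e (φ (v w))
    φw∈e = subst (inEdge K e) (sym φw≡vu) (from (v∈edge⇔ e u e≤m) (≤-trans e≤m m≤u , u≤p+m))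

    d : Edge
    d = proj₁ (σ-surjective e)

    σd≡e : σ d ≡ e
    σd≡e = proj₂ (σ-surjective e)

    d≤p : toℕ d ≤ p
    d≤p = below-reflected σ p fixed d (subst (λ c → toℕ c ≤ p) (sym σd≡e) ≤-refl)

    p≤d : p ≤ toℕ d
    p≤d = +-cancelʳ-≤ m p (toℕ d)
      (subst (_≤ toℕ d + m) toℕ-w
        (proj₂ (to (v∈edge⇔ d w (≤-trans d≤p e≤m))
                   (∈-reflected (subst (λ c → inEdge K c (φ (v w))) (sym σd≡e) φw∈e)))))

    σe≡e : σ e ≡ e
    σe≡e = subst (λ c → σ c ≡ e) (toℕ-injective (≤-antisym d≤p p≤d)) σd≡e

  fixedFrom : ∀ d p → p + d ≡ suc m → FixedFrom p
  fixedFrom zero p p+0≡K e p≤e = subst (λ c → σ c ≡ c) (sym e≡star) σ-star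
    where
      p≡K : p ≡ K
      p≡K = trans (sym (+-identityʳ p)) p+0≡K
      e≡star : e ≡ star
      e≡star = toℕ-injective (trans (≤-antisym (toℕ≤pred[n] e) (subst (_≤ toℕ e) p≡K p≤e))
                                    (sym (toℕ-fromℕ K)))
  fixedFrom (suc d) p p+1+d≡K e p≤e with p ≟ toℕ e
  ... | yes refl = WindowStep.σe≡e e (s≤s⁻¹ p<K) fixedFrom-suc
    where
      p<K : p < K
      p<K = subst (p <_) p+1+d≡K (m<m+n p (s≤s z≤n))
      fixedFrom-suc : FixedFrom (suc p)
      fixedFrom-suc = fixedFrom d (suc p) (trans (sym (+-suc p d)) p+1+d≡K)
  ... | no p≢e = fixedFrom d (suc p) (trans (sym (+-suc p d)) p+1+d≡K) e (≤∧≢⇒< p≤e p≢e)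

  σ-id : ∀ e → σ e ≡ e
  σ-id e = fixedFrom K 0 refl e z≤n

  φ-fixes-v : ∀ t → φ (v t) ≡ v t
  φ-fixes-v t = trans φt≡vu (cong v (toℕ-injective u≡t))
    where
      u : Point
      u = proj₁ (v-image t)
      φt≡vu : φ (v t) ≡ v u
      φt≡vu = proj₂ (v-image t)

      same : SameWindows m (toℕ u) (toℕ t)
      same j j≤m =
        v∈window⇔ j j≤m t ⇔-∘
          (⇔-sym (∈-fixedEdge (σ-id (window j j≤m))) ⇔-∘
            (subst (λ y → InWindow m j (toℕ u) ⇔ inEdge K (window j j≤m) y) (sym φt≡vu)
              (⇔-sym (v∈window⇔ j j≤m u))))

      u≡t : toℕ u ≡ toℕ t
      u≡t = sameWindows⇒≡ m (toℕ-point≤ u) (toℕ-point≤ t) same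

lemma15 : (k : ℕ) → 4 ≤ k → (φ : Vtx k → Vtx k) → IsAutomorphism k φ
    → φ x ≡ x
    → (∀ (i : Fin (2 * k ∸ 1)) → toℕ i ≡ 2 * k ∸ 2 → φ (v i) ≡ v i)
    → (∀ (i : Fin (2 * k ∸ 1)) → φ (v i) ≡ v i) × φ x ≡ x
lemma15 (suc m) (s≤s 3≤m) φ aut φx≡x φ-last =
  Rigidity.φ-fixes-v m (≤-trans (s≤s (s≤s z≤n)) 3≤m) aut φx≡x φ-last′ , φx≡x
  where
    φ-last′ : ∀ t → toℕ t ≡ m + m → φ (v t) ≡ v t
    φ-last′ t t≡2m = φ-last t (trans t≡2m (sym (cong (_∸ 1) (2[1+m]∸1≡1+2m m))))
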